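{- Let $k\ge 1$ and let $G$ be a finite simple connected graph of order $n(G)$. Then $\mathrm{f}\mu^{k}(G)=n(G)-k-1$ if and only if $G\in\mathcal{H}_{n(G),k}$.
   Context: For an integer $k\ge 0$ and a connected graph $G$, a set $X\subseteq V(G)$ is a $k$-fault-tolerant mutual-visibility set ($k$-ftmv set) if for any two non-adjacent vertices $u,v\in X$ there exist $k+1$ internally vertex-disjoint shortest $u,v$-paths $Q_1,\dots,Q_{k+1}$ in $G$ such that $V(Q_i)\cap X=\{u,v\}$ for every $i$. $\mathrm{f}\mu^{k}(G)$ denotes the maximum cardinality of a $k$-ftmv set of $G$. For $k\ge 1$ and $n\ge k+2$, the family $\mathcal{H}_{n,k}$ consists of all graphs $\widehat{H}$ obtained as follows: take an arbitrary graph $H$ of order $n-k-1$; let $A$ be the (possibly empty) set of universal vertices of $H$ (vertices adjacent to all other vertices of $H$) and $B=V(H)\setminus A$; add a set $W$ of $k+1$ new vertices and all edges between $W$ and $B$; finally add some arbitrary edges among the vertices of $W$ and some arbitrary edges between $W$ and $A$, such that the resulting graph $\widehat{H}$ (of order $n$) is connected and has clique number $\omega(\widehat{H})\le n-k-1$. -}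

module Defs where

open import Data.Nat using (ℕ; zero; suc; _<_; _≤_; _∸_)
open import Data.Fin using (Fin; zero; suc; toℕ; fromℕ; inject₁)
open import Data.Fin.Subset using (Subset; _∈_; _∉_; ∣_∣)
open import Data.Bool using (Bool; true; false)
open import Data.Product using (Σ; _×_; ∃)
open import Relation.Nullary using (¬_)
open import Relation.Binary.PropositionalEquality using (_≡_; _≢_)

record Graph (n : ℕ) : Set where
  field
    adj    : Fin n → Fin n → Bool
    sym    : ∀ u v → adj u v ≡ adj v u
    irrefl : ∀ u → adj u u ≡ false

open Graph public

Adj : ∀ {n} → Graph n → Fin n → Fin n → Set
Adj G u v = adj G u v ≡ true

record Walk {n : ℕ} (G : Graph n) (u v : Fin n) : Set where
  field
    len   : ℕ
    vtx   : Fin (suc len) → Fin n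
    start : vtx zero ≡ u
    end   : vtx (fromℕ len) ≡ v
    step  : (i : Fin len) → Adj G (vtx (inject₁ i)) (vtx (suc i))

open Walk public

-- A shortest u,v-path: a u,v-walk of minimum length (such walks are paths).
Shortest : ∀ {n} {G : Graph n} {u v : Fin n} → Walk G u v → Set
Shortest {G = G} {u} {v} w = ∀ (w' : Walk G u v) → len w ≤ len w'

Internal : ∀ {n} {G : Graph n} {u v : Fin n} → Walk G u v → Fin n → Set
Internal w x = Σ (Fin (suc (len w))) λ i → (0 < toℕ i) × (toℕ i < len w) × (vtx w i ≡ x)

Connected : ∀ {n} → Graph n → Set
Connected G = ∀ u v → Walk G u v

IsFTMV : ∀ {n} → Graph n → ℕ → Subset n → Set
IsFTMV G k X =
  ∀ u v → u ∈ X → v ∈ X → u ≢ v → ¬ Adj G u v →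
  Σ (Fin (suc k) → Walk G u v) λ Q →
      (∀ i → Shortest (Q i))
    × (∀ i j → i ≢ j → ∀ x → Internal (Q i) x → ¬ Internal (Q j) x)
    × (∀ i x → Internal (Q i) x → x ∉ X)

FMuEq : ∀ {n} → Graph n → ℕ → ℕ → Set
FMuEq {n} G k m =
  (Σ (Subset n) λ X → IsFTMV G k X × ∣ X ∣ ≡ m)
  × (∀ (X : Subset n) → IsFTMV G k X → ∣ X ∣ ≤ m)

IsClique : ∀ {n} → Graph n → Subset n → Set
IsClique G C = ∀ u v → u ∈ C → v ∈ C → u ≢ v → Adj G u v

CliqueNumber≤ : ∀ {n} → Graph n → ℕ → Set
CliqueNumber≤ {n} G m = ∀ (C : Subset n) → IsClique G C → ∣ C ∣ ≤ m

UniversalOutside : ∀ {n} → Graph n → Subset n → Fin n → Set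
UniversalOutside G W a = a ∉ W × (∀ x → x ∉ W → x ≢ a → Adj G a x)

-- G ∈ H_{n,k}: G arises (up to the identity labelling of its own vertices) from the
-- construction: H = G - W of order n-k-1, W of size k+1, every vertex of W adjacent to
-- every non-universal vertex of H (the set B), edges inside W and between W and A arbitrary,
-- G connected and ω(G) ≤ n-k-1.
InH : ∀ {n} → Graph n → ℕ → Set
InH {n} G k =
  (suc (suc k) ≤ n) ×
  Σ (Subset n) λ W →
      (∣ W ∣ ≡ suc k)
    × (∀ w b → w ∈ W → b ∉ W → ¬ UniversalOutside G W b → Adj G w b)
    × Connected G
    × CliqueNumber≤ G (n ∸ suc k)

{-# OPTIONS --safe #-}
-- Let u, v be distinct non-adjacent vertices of a k-ftmv set X. The second vertices
-- of the k+1 internally disjoint shortest u,v-paths are k+1 distinct neighbours of u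
-- outside X; so either X is a clique or |X| ≤ n-k-1. Hence fμ^k(G) = n-k-1 means that
-- ω(G) ≤ n-k-1 and that a maximum k-ftmv set X has a complement W of exactly k+1
-- vertices, which then must all be adjacent to every vertex of X having a non-neighbour
-- in X, i.e. to every non-universal vertex of G - W. Conversely, for G in H_{n,k}, two
-- non-adjacent vertices outside W are both non-universal in G - W, so the k+1 paths
-- u w v (w ∈ W) witness that V(G) ∖ W is a k-ftmv set.
module Submission where

open import Defs
open import Data.Nat using (ℕ; _≤_; _∸_; suc)
open import Function.Bundles using (_⇔_)

open import Data.Bool using (true) renaming (_≟_ to _≟ᵇ_)
open import Data.Empty using (⊥-elim)
open import Data.Fin using (Fin; zero; suc; inject₁; fromℕ<; _≟_)
open import Data.Fin.Properties using (any?; injective⇒≤; suc-injective)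
open import Data.Fin.Subset using (Subset; _∈_; _∉_; ∣_∣; ∁; ⁅_⁆; inside; outside)
open import Data.Fin.Subset.Properties
  using (_∈?_; x∈⁅y⁆⇒x≡y; ∣⁅x⁆∣≡1; x∉∁p⇒x∈p; x∉p⇒x∈∁p; x∈∁p⇒x∉p; x∈p⇒x∉∁p; ∣∁p∣≡n∸∣p∣; ∣p∣≤n)
open import Data.Nat using (zero; z≤n; s≤s)
open import Data.Nat.Properties
  using (≤-trans; ≤-reflexive; <⇒≤; 1+n≰n; ∸-monoʳ-≤; m∸[m∸n]≡n; m∸n≢0⇒n<m; n>0⇒n≢0)
open import Data.Product using (Σ; ∃; ∃₂; _×_; _,_; proj₁; proj₂)
open import Data.Sum using (_⊎_; inj₁; inj₂; [_,_])
open import Data.Vec using (_∷_)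
open import Data.Vec.Base using (here; there)
open import Function using (_∘_; id; mk⇔)
open import Function.Definitions using (Injective)
open import Relation.Nullary using (¬_; Dec; yes; no)
open import Relation.Nullary.Decidable using (_×-dec_; ¬?)
open import Relation.Binary.PropositionalEquality
  using (_≡_; _≢_; refl; trans; cong; subst; subst₂) renaming (sym to ≡-sym)

private
  variable
    n m : ℕ

record DistinctMembers (m : ℕ) (p : Subset n) : Set where
  field
    pick           : Fin m → Fin n
    pick∈          : ∀ i → pick i ∈ p
    pick-injective : Injective _≡_ _≡_ pick

open DistinctMembers

rank : (p : Subset n) {x : Fin n} → x ∈ p → Fin ∣ p ∣
rank (inside  ∷ p) here       = zero
rank (inside  ∷ p) (there x∈) = suc (rank p x∈)
rank (outside ∷ p) (there x∈) = rank p x∈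

rank-injective : (p : Subset n) {x y : Fin n} (x∈p : x ∈ p) (y∈p : y ∈ p) →
                 rank p x∈p ≡ rank p y∈p → x ≡ y
rank-injective (inside  ∷ p) here       here       _  = refl
rank-injective (inside  ∷ p) (there x∈) (there y∈) eq =
  cong suc (rank-injective p x∈ y∈ (suc-injective eq))
rank-injective (outside ∷ p) (there x∈) (there y∈) eq =
  cong suc (rank-injective p x∈ y∈ eq)

nth : (p : Subset n) → Fin ∣ p ∣ → Fin n
nth (inside  ∷ p) zero    = zero
nth (inside  ∷ p) (suc i) = suc (nth p i)
nth (outside ∷ p) i       = suc (nth p i)

nth∈ : (p : Subset n) (i : Fin ∣ p ∣) → nth p i ∈ p
nth∈ (inside  ∷ p) zero    = here
nth∈ (inside  ∷ p) (suc i) = there (nth∈ p i)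
nth∈ (outside ∷ p) i       = there (nth∈ p i)

nth-injective : (p : Subset n) → Injective _≡_ _≡_ (nth p)
nth-injective (inside  ∷ p) {zero}  {zero}  _  = refl
nth-injective (inside  ∷ p) {suc i} {suc j} eq = cong suc (nth-injective p (suc-injective eq))
nth-injective (outside ∷ p)                 eq = nth-injective p (suc-injective eq)

allMembers : (p : Subset n) → DistinctMembers ∣ p ∣ p
allMembers p = record { pick = nth p ; pick∈ = nth∈ p ; pick-injective = nth-injective p }

DistinctMembers⇒≤∣p∣ : {p : Subset n} → DistinctMembers m p → m ≤ ∣ p ∣
DistinctMembers⇒≤∣p∣ {p = p} M =
  injective⇒≤ λ eq → pick-injective M (rank-injective p (pick∈ M _) (pick∈ M _) eq)

extend : {p : Subset n} {x : Fin n} (M : DistinctMembers m p) →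
         x ∈ p → (∀ i → pick M i ≢ x) → DistinctMembers (suc m) p
extend {n = n} {m = m} {p = p} {x = x} M x∈p new =
  record { pick = pick′ ; pick∈ = pick∈′ ; pick-injective = injective′ }
  where
    pick′ : Fin (suc m) → Fin n
    pick′ zero    = x
    pick′ (suc i) = pick M i
    pick∈′ : ∀ i → pick′ i ∈ p
    pick∈′ zero    = x∈p
    pick∈′ (suc i) = pick∈ M i
    injective′ : Injective _≡_ _≡_ pick′
    injective′ {zero}  {zero}  _  = refl
    injective′ {zero}  {suc j} eq = ⊥-elim (new j (≡-sym eq))
    injective′ {suc i} {zero}  eq = ⊥-elim (new i eq)
    injective′ {suc i} {suc j} eq = cong suc (pick-injective M eq)

DistinctMembers-onto : {p : Subset n} (M : DistinctMembers m p) → ∣ p ∣ ≤ m →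
                       ∀ {x} → x ∈ p → ∃ λ i → pick M i ≡ x
DistinctMembers-onto M ∣p∣≤m {x} x∈p with any? (λ i → pick M i ≟ x)
... | yes hit = hit
... | no miss =
  ⊥-elim (1+n≰n (≤-trans (DistinctMembers⇒≤∣p∣ (extend M x∈p (λ i eq → miss (i , eq)))) ∣p∣≤m))

≤∣∁p∣⇒∣p∣≤n∸ : (p : Subset n) → m ≤ ∣ ∁ p ∣ → ∣ p ∣ ≤ n ∸ m
≤∣∁p∣⇒∣p∣≤n∸ {n = n} p m≤∣∁p∣ =
  subst (_≤ _) (m∸[m∸n]≡n (∣p∣≤n p)) (∸-monoʳ-≤ n (subst (_ ≤_) (∣∁p∣≡n∸∣p∣ p) m≤∣∁p∣))

∣p∣≡n∸m⇒∣∁p∣≡m : (p : Subset n) → m ≤ n → ∣ p ∣ ≡ n ∸ m → ∣ ∁ p ∣ ≡ m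
∣p∣≡n∸m⇒∣∁p∣≡m {n = n} p m≤n ∣p∣≡n∸m =
  trans (∣∁p∣≡n∸∣p∣ p) (trans (cong (n ∸_) ∣p∣≡n∸m) (m∸[m∸n]≡n m≤n))

module _ {n : ℕ} (G : Graph n) where

  Adj-sym : ∀ {u v} → Adj G u v → Adj G v u
  Adj-sym {u} {v} = trans (Graph.sym G v u)

  NonNeighbourIn : Subset n → Fin n → Set
  NonNeighbourIn S b = ∃ λ x → x ∈ S × x ≢ b × ¬ Adj G b x

  nonNeighbourIn? : ∀ S b → Dec (NonNeighbourIn S b)
  nonNeighbourIn? S b = any? λ x → (x ∈? S) ×-dec ¬? (x ≟ b) ×-dec ¬? (adj G b x ≟ᵇ true)

  ¬nonNeighbour⇒adjacent : ∀ {S b} → ¬ NonNeighbourIn S b → ∀ x → x ∈ S → x ≢ b → Adj G b x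
  ¬nonNeighbour⇒adjacent {b = b} none x x∈S x≢b with adj G b x ≟ᵇ true
  ... | yes b~x = b~x
  ... | no  b≁x = ⊥-elim (none (x , x∈S , x≢b , b≁x))

  NonadjacentPairIn : Subset n → Set
  NonadjacentPairIn X = ∃₂ λ u v → u ∈ X × v ∈ X × u ≢ v × ¬ Adj G u v

  nonadjacentPair-or-clique : ∀ X → NonadjacentPairIn X ⊎ IsClique G X
  nonadjacentPair-or-clique X with any? (λ u → (u ∈? X) ×-dec nonNeighbourIn? X u)
  ... | yes (u , u∈X , v , v∈X , v≢u , u≁v) = inj₁ (u , v , u∈X , v∈X , v≢u ∘ ≡-sym , u≁v)
  ... | no  none = inj₂ λ u v u∈X v∈X u≢v →
    ¬nonNeighbour⇒adjacent (λ nn → none (u , u∈X , nn)) v v∈X (u≢v ∘ ≡-sym)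

  module _ {u v : Fin n} (u≢v : u ≢ v) (u≁v : ¬ Adj G u v) where

    nonadjacent⇒2≤len : (w : Walk G u v) → 2 ≤ len w
    nonadjacent⇒2≤len record { len = zero ; start = s ; end = e } = ⊥-elim (u≢v (trans (≡-sym s) e))
    nonadjacent⇒2≤len record { len = suc zero ; start = s ; end = e ; step = st } =
      ⊥-elim (u≁v (subst₂ (Adj G) s e (st zero)))
    nonadjacent⇒2≤len record { len = suc (suc _) } = s≤s (s≤s z≤n)

    internalNeighbour : (w : Walk G u v) → ∃ λ y → Adj G u y × Internal w y
    internalNeighbour w@record { len = zero } with nonadjacent⇒2≤len w
    ... | ()
    internalNeighbour w@record { len = suc zero } with nonadjacent⇒2≤len w
    ... | s≤s ()
    internalNeighbour record { len = suc (suc _) ; vtx = f ; start = s ; step = st } =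
      f (suc zero) , subst (λ z → Adj G z (f (suc zero))) s (st zero) ,
      suc zero , s≤s z≤n , s≤s (s≤s z≤n) , refl

  twoStep : ∀ {u y v} → Adj G u y → Adj G y v → Walk G u v
  twoStep {u} {y} {v} u~y y~v = record { len = 2 ; vtx = f ; start = refl ; end = refl ; step = st }
    where
      f : Fin 3 → Fin n
      f zero             = u
      f (suc zero)       = y
      f (suc (suc zero)) = v
      st : (i : Fin 2) → Adj G (f (inject₁ i)) (f (suc i))
      st zero       = u~y
      st (suc zero) = y~v

  twoStep-internal : ∀ {u y v x} (u~y : Adj G u y) (y~v : Adj G y v) →
                     Internal (twoStep u~y y~v) x → y ≡ x
  twoStep-internal _ _ (suc zero , _ , _ , y≡x)            = y≡x
  twoStep-internal _ _ (suc (suc zero) , _ , s≤s (s≤s ()) , _)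

  module _ (k : ℕ) where

    clique⇒ftmv : ∀ {C} → IsClique G C → IsFTMV G k C
    clique⇒ftmv clique u v u∈C v∈C u≢v u≁v = ⊥-elim (u≁v (clique u v u∈C v∈C u≢v))

    ftmv⇒neighboursOutside : ∀ {X u v} → IsFTMV G k X → u ∈ X → v ∈ X → u ≢ v → ¬ Adj G u v →
                             Σ (DistinctMembers (suc k) (∁ X)) λ M → ∀ i → Adj G u (pick M i)
    ftmv⇒neighboursOutside ftmv u∈X v∈X u≢v u≁v with ftmv _ _ u∈X v∈X u≢v u≁v
    ... | Q , _ , disjoint , avoidsX = M , λ i → proj₁ (proj₂ (second i))
      where
        second : ∀ i → ∃ λ y → Adj G _ y × Internal (Q i) y
        second i = internalNeighbour u≢v u≁v (Q i)
        injective : Injective _≡_ _≡_ (proj₁ ∘ second)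
        injective {i} {j} eq with i ≟ j
        ... | yes i≡j = i≡j
        ... | no  i≢j = ⊥-elim (disjoint i j i≢j _ (proj₂ (proj₂ (second i)))
                                  (subst (Internal (Q j)) (≡-sym eq) (proj₂ (proj₂ (second j)))))
        M : DistinctMembers (suc k) (∁ _)
        M = record { pick = proj₁ ∘ second
                   ; pick∈ = λ i → x∉p⇒x∈∁p (avoidsX i _ (proj₂ (proj₂ (second i))))
                   ; pick-injective = injective }

    ftmv⇒clique-or-≤n∸k+1 : ∀ {X} → IsFTMV G k X → IsClique G X ⊎ ∣ X ∣ ≤ n ∸ suc k
    ftmv⇒clique-or-≤n∸k+1 {X} ftmv with nonadjacentPair-or-clique X
    ... | inj₂ clique = inj₁ clique
    ... | inj₁ (_ , _ , u∈X , v∈X , u≢v , u≁v) =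
      inj₂ (≤∣∁p∣⇒∣p∣≤n∸ X
              (DistinctMembers⇒≤∣p∣ (proj₁ (ftmv⇒neighboursOutside ftmv u∈X v∈X u≢v u≁v))))

    ftmv-tight⇒adjacentToComplement : ∀ {X b w} → IsFTMV G k X → ∣ ∁ X ∣ ≡ suc k →
                                     b ∈ X → NonNeighbourIn X b → w ∈ ∁ X → Adj G w b
    ftmv-tight⇒adjacentToComplement ftmv tight b∈X (x , x∈X , x≢b , b≁x) w∈∁X
      with ftmv⇒neighboursOutside ftmv b∈X x∈X (x≢b ∘ ≡-sym) b≁x
    ... | M , b~M with DistinctMembers-onto M (≤-reflexive tight) w∈∁X
    ... | i , Mi≡w = subst (λ z → Adj G z _) Mi≡w (Adj-sym (b~M i))

    complement-ftmv : ∀ {W} → DistinctMembers (suc k) W →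
                      (∀ {u v} → u ∉ W → v ∉ W → u ≢ v → ¬ Adj G u v →
                         ∀ {w} → w ∈ W → Adj G u w × Adj G w v) →
                      IsFTMV G k (∁ W)
    complement-ftmv {W} M common u v u∈ v∈ u≢v u≁v = Q , shortest , disjoint , avoids
      where
        edges : ∀ i → Adj G u (pick M i) × Adj G (pick M i) v
        edges i = common (x∈∁p⇒x∉p u∈) (x∈∁p⇒x∉p v∈) u≢v u≁v (pick∈ M i)
        Q : Fin (suc k) → Walk G u v
        Q i = twoStep (proj₁ (edges i)) (proj₂ (edges i))
        internal : ∀ {i x} → Internal (Q i) x → pick M i ≡ x
        internal {i} = twoStep-internal (proj₁ (edges i)) (proj₂ (edges i))
        shortest : ∀ i → Shortest (Q i)
        shortest _ = nonadjacent⇒2≤len u≢v u≁v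
        disjoint : ∀ i j → i ≢ j → ∀ x → Internal (Q i) x → ¬ Internal (Q j) x
        disjoint i j i≢j x in-i in-j =
          i≢j (pick-injective M (trans (internal in-i) (≡-sym (internal in-j))))
        avoids : ∀ i x → Internal (Q i) x → x ∉ ∁ W
        avoids i x in-i = x∈p⇒x∉∁p (subst (_∈ W) (internal in-i) (pick∈ M i))

  nonadjacent⇒nonUniversal : ∀ {W u v} → u ∉ W → u ≢ v → ¬ Adj G u v → ¬ UniversalOutside G W v
  nonadjacent⇒nonUniversal u∉W u≢v u≁v (_ , universal) = u≁v (Adj-sym (universal _ u∉W u≢v))

module _ {n : ℕ} (G : Graph n) (k : ℕ) where

  FMuEq⇒InH : 1 ≤ n → Connected G → FMuEq G k (n ∸ suc k) → InH G k
  FMuEq⇒InH 1≤n connected ((X , ftmv , ∣X∣≡) , maximum) =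
    k+2≤n , ∁ X , ∣∁X∣≡ , adjacent , connected , λ C clique → maximum C (clique⇒ftmv G k clique)
    where
      vertex : Fin n
      vertex = fromℕ< 1≤n
      singleton-clique : IsClique G ⁅ vertex ⁆
      singleton-clique u v u∈ v∈ u≢v =
        ⊥-elim (u≢v (trans (x∈⁅y⁆⇒x≡y _ u∈) (≡-sym (x∈⁅y⁆⇒x≡y _ v∈))))
      1≤n∸k+1 : 1 ≤ n ∸ suc k
      1≤n∸k+1 = subst (_≤ n ∸ suc k) (∣⁅x⁆∣≡1 vertex) (maximum _ (clique⇒ftmv G k singleton-clique))
      k+2≤n : suc (suc k) ≤ n
      k+2≤n = m∸n≢0⇒n<m (n>0⇒n≢0 1≤n∸k+1)
      ∣∁X∣≡ : ∣ ∁ X ∣ ≡ suc k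
      ∣∁X∣≡ = ∣p∣≡n∸m⇒∣∁p∣≡m X (<⇒≤ k+2≤n) ∣X∣≡
      adjacent : ∀ w b → w ∈ ∁ X → b ∉ ∁ X → ¬ UniversalOutside G (∁ X) b → Adj G w b
      adjacent w b w∈ b∉ nonUniversal with nonNeighbourIn? G X b
      ... | yes nn  = ftmv-tight⇒adjacentToComplement G k ftmv ∣∁X∣≡ (x∉∁p⇒x∈p b∉) nn w∈
      ... | no none =
        ⊥-elim (nonUniversal (b∉ , λ x x∉ → ¬nonNeighbour⇒adjacent G none x (x∉∁p⇒x∈p x∉)))

  InH⇒FMuEq : InH G k → FMuEq G k (n ∸ suc k)
  InH⇒FMuEq (_ , W , ∣W∣≡ , adjacent , _ , ω≤) =
    (∁ W , ftmv , trans (∣∁p∣≡n∸∣p∣ W) (cong (n ∸_) ∣W∣≡)) ,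
    λ X ftmvX → [ ω≤ X , id ] (ftmv⇒clique-or-≤n∸k+1 G k ftmvX)
    where
      common : ∀ {u v} → u ∉ W → v ∉ W → u ≢ v → ¬ Adj G u v →
               ∀ {w} → w ∈ W → Adj G u w × Adj G w v
      common u∉ v∉ u≢v u≁v w∈ =
        Adj-sym G
          (adjacent _ _ w∈ u∉ (nonadjacent⇒nonUniversal G v∉ (u≢v ∘ ≡-sym) (u≁v ∘ Adj-sym G))) ,
        adjacent _ _ w∈ v∉ (nonadjacent⇒nonUniversal G u∉ u≢v u≁v)
      ftmv : IsFTMV G k (∁ W)
      ftmv = complement-ftmv G k (subst (λ m → DistinctMembers m W) ∣W∣≡ (allMembers W)) common

theorem5p4 : ∀ {n : ℕ} (G : Graph n) (k : ℕ) → 1 ≤ k → 1 ≤ n → Connected G →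
    (FMuEq G k (n ∸ suc k) ⇔ InH G k)
theorem5p4 G k _ 1≤n connected = mk⇔ (FMuEq⇒InH G k 1≤n connected) (InH⇒FMuEq G k)
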